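{- Let $\mathsf{L}$ be an intermediate logic. Every formula of the form $\neg\phi$ that is consistent in $\mathsf{L}^\neg$ is $\mathcal{ST}$-projective in $\mathsf{L}^\neg$, where $\mathcal{ST}$ is the class of all substitutions that are stable in $\mathsf{L}^\neg$.
   Context: Formulas are those of intuitionistic propositional logic (variables, $\bot,\top$, $\wedge,\vee,\to$; $\neg\phi:=\phi\to\bot$). An intermediate theory is a set $\mathsf{T}$ of formulas closed under modus ponens with $\mathsf{IPC}\subseteq\mathsf{T}\subseteq\mathsf{CPC}$; an intermediate logic is an intermediate theory closed under uniform substitution. $\Gamma\vdash_{\mathsf{T}}\phi$ means $\phi$ is derivable from $\mathsf{T}\cup\Gamma$ by modus ponens; $\vdash_{\mathsf{T}}\phi$ means $\phi\in\mathsf{T}$. A formula $\psi$ is consistent in $\mathsf{T}$ if $\neg\psi\notin\mathsf{T}$. The negative variant of an intermediate logic $\mathsf{L}$ is $\mathsf{L}^\neg=\{\phi\mid\phi^\neg\in\mathsf{L}\}$ where $\phi^\neg$ replaces each variable $p$ by $\neg p$. A substitution (map on formulas commuting with connectives) $\sigma$ is stable in $\mathsf{L}^\neg$ if $\vdash_{\mathsf{L}^\neg}\sigma(p)\leftrightarrow\neg\neg\sigma(p)$ for all variables $p$. For a set $\mathcal{S}$ of substitutions, $\psi$ is $\mathcal{S}$-projective in $\mathsf{T}$ if there is $\sigma\in\mathcal{S}$ with $\vdash_{\mathsf{T}}\sigma(\psi)$ and, for every variable $p$, $\psi,\sigma(p)\vdash_{\mathsf{T}}p$ and $\psi,p\vdash_{\mathsf{T}}\sigma(p)$.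 -}

module Defs where

open import Level using (Level; _⊔_) renaming (zero to lzero; suc to lsuc)
open import Data.Nat using (ℕ)
open import Data.Bool using (Bool; true; false; _∧_; _∨_; not)
open import Data.List using (List; _∷_; [])
open import Data.List.Membership.Propositional using (_∈_)
open import Data.Product using (Σ; _×_)
open import Relation.Binary.PropositionalEquality using (_≡_)
open import Relation.Nullary using (¬_)

infixr 6 _∧'_
infixr 5 _∨'_
infixr 4 _⇒_
infix  3 _⇔_

data Fm : Set where
  var  : ℕ → Fm
  ⊥'   : Fm
  ⊤'   : Fm
  _∧'_ : Fm → Fm → Fm
  _∨'_ : Fm → Fm → Fm
  _⇒_  : Fm → Fm → Fm

~_ : Fm → Fm
~ a = a ⇒ ⊥'

_⇔_ : Fm → Fm → Fm
a ⇔ b = (a ⇒ b) ∧' (b ⇒ a)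

Subst : Set
Subst = ℕ → Fm

sub : Subst → Fm → Fm
sub σ (var p)  = σ p
sub σ ⊥'       = ⊥'
sub σ ⊤'       = ⊤'
sub σ (a ∧' b) = sub σ a ∧' sub σ b
sub σ (a ∨' b) = sub σ a ∨' sub σ b
sub σ (a ⇒ b)  = sub σ a ⇒ sub σ b

neg-var : Fm → Fm
neg-var = sub (λ p → ~ var p)

data IPC : Fm → Set where
  ax-K  : ∀ a b → IPC (a ⇒ b ⇒ a)
  ax-S  : ∀ a b c → IPC ((a ⇒ b ⇒ c) ⇒ (a ⇒ b) ⇒ a ⇒ c)
  ax-∧1 : ∀ a b → IPC (a ∧' b ⇒ a)
  ax-∧2 : ∀ a b → IPC (a ∧' b ⇒ b)
  ax-∧I : ∀ a b → IPC (a ⇒ b ⇒ a ∧' b)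
  ax-∨1 : ∀ a b → IPC (a ⇒ a ∨' b)
  ax-∨2 : ∀ a b → IPC (b ⇒ a ∨' b)
  ax-∨E : ∀ a b c → IPC ((a ⇒ c) ⇒ (b ⇒ c) ⇒ a ∨' b ⇒ c)
  ax-⊥  : ∀ a → IPC (⊥' ⇒ a)
  ax-⊤  : IPC ⊤'
  mp    : ∀ {a b} → IPC (a ⇒ b) → IPC a → IPC b

_⇒ᵇ_ : Bool → Bool → Bool
x ⇒ᵇ y = not x ∨ y

eval : (ℕ → Bool) → Fm → Bool
eval v (var p)  = v p
eval v ⊥'       = false
eval v ⊤'       = true
eval v (a ∧' b) = eval v a ∧ eval v b
eval v (a ∨' b) = eval v a ∨ eval v b
eval v (a ⇒ b)  = eval v a ⇒ᵇ eval v b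

CPC : Fm → Set
CPC φ = ∀ (v : ℕ → Bool) → eval v φ ≡ true

Th : (ℓ : Level) → Set (lsuc ℓ)
Th ℓ = Fm → Set ℓ

record IsIntermediateTheory {ℓ : Level} (T : Th ℓ) : Set ℓ where
  field
    closed-mp : ∀ {a b} → T (a ⇒ b) → T a → T b
    ipc⊆      : ∀ {a} → IPC a → T a
    ⊆cpc      : ∀ {a} → T a → CPC a

record IsIntermediateLogic {ℓ : Level} (L : Th ℓ) : Set ℓ where
  field
    isTheory     : IsIntermediateTheory L
    closed-subst : ∀ (σ : Subst) {a} → L a → L (sub σ a)

Neg : {ℓ : Level} → Th ℓ → Th ℓ
Neg L φ = L (neg-var φ)

data _,_⊢_ {ℓ : Level} (T : Th ℓ) (Γ : List Fm) : Fm → Set ℓ where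
  inT : ∀ {a} → T a → T , Γ ⊢ a
  hyp : ∀ {a} → a ∈ Γ → T , Γ ⊢ a
  mp  : ∀ {a b} → T , Γ ⊢ (a ⇒ b) → T , Γ ⊢ a → T , Γ ⊢ b

Consistent : {ℓ : Level} → Th ℓ → Fm → Set ℓ
Consistent T ψ = ¬ T (~ ψ)

Stable : {ℓ : Level} → Th ℓ → Subst → Set ℓ
Stable T σ = ∀ (p : ℕ) → T (σ p ⇔ ~ ~ σ p)

Projective : {ℓ ℓ' : Level} → (Subst → Set ℓ') → Th ℓ → Fm → Set (ℓ ⊔ ℓ')
Projective S T ψ =
  Σ Subst λ σ → S σ × T (sub σ ψ)
    × (∀ (p : ℕ) → (T , (ψ ∷ σ p ∷ []) ⊢ var p)
                 × (T , (ψ ∷ var p ∷ []) ⊢ σ p))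

module Submission where

open import Level using (Level)
open import Defs
open import Data.Nat using (ℕ; zero; suc; _<_; _⊔_; _≟_)
open import Data.Nat.Properties using (<-≤-trans; m≤m⊔n; m≤n⊔m; n<1+n; <⇒≢; m<1+n⇒m<n∨m≡n)
open import Data.Bool using (Bool; true; false; if_then_else_; _∧_; _∨_)
open import Data.List using (List; _∷_; [])
open import Data.List.Relation.Unary.Any using (here; there)
open import Data.Product using (∃; _,_; proj₁; proj₂)
open import Data.Sum using (_⊎_; inj₁; inj₂)
open import Relation.Nullary using (does; contradiction)
open import Relation.Nullary.Decidable using (dec-true; dec-false)
open import Relation.Unary using (_⊆_)
open import Relation.Binary.PropositionalEquality using (_≡_; refl; sym; trans; cong; cong₂; module ≡-Reasoning)

-- Kalmár's lemma, applied to every valuation of the finitely many variables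
-- of χ, shows that χ is either classically satisfiable or refutable in IPC.
-- Since ¬φ is consistent in L¬ ⊇ IPC, some valuation w₀ satisfies ¬φ.  The
-- substitution σ(p) = ¬φ → p if w₀(p), ¬φ ∧ p otherwise, fixes valuations
-- satisfying ¬φ and sends all others to w₀; hence σ(¬φ) = ¬σ(φ) is a
-- tautology, and as a negation it is an IPC theorem.  Under (·)^¬ the two
-- shapes of σ(p) become A → ¬p and ¬A ∧ ¬p, which are ¬¬-stable in IPC.

infix 2 _⊢ᵢ_

_⊢ᵢ_ : List Fm → Fm → Set
Γ ⊢ᵢ a = IPC , Γ ⊢ a

IPC-subst : ∀ σ {a} → IPC a → IPC (sub σ a)
IPC-subst σ (ax-K a b)    = ax-K _ _
IPC-subst σ (ax-S a b c)  = ax-S _ _ _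
IPC-subst σ (ax-∧1 a b)   = ax-∧1 _ _
IPC-subst σ (ax-∧2 a b)   = ax-∧2 _ _
IPC-subst σ (ax-∧I a b)   = ax-∧I _ _
IPC-subst σ (ax-∨1 a b)   = ax-∨1 _ _
IPC-subst σ (ax-∨2 a b)   = ax-∨2 _ _
IPC-subst σ (ax-∨E a b c) = ax-∨E _ _ _
IPC-subst σ (ax-⊥ a)      = ax-⊥ _
IPC-subst σ ax-⊤          = ax-⊤
IPC-subst σ (mp f x)      = mp (IPC-subst σ f) (IPC-subst σ x)

IPC⊆Neg : ∀ {ℓ} {L : Th ℓ} → IPC ⊆ L → IPC ⊆ Neg L
IPC⊆Neg IPC⊆L d = IPC⊆L (IPC-subst (λ p → ~ var p) d)

⊢-mono : ∀ {ℓ ℓ'} {T : Th ℓ} {T' : Th ℓ'} → T ⊆ T' → ∀ {Γ a} → T , Γ ⊢ a → T' , Γ ⊢ a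
⊢-mono T⊆T' (inT x)  = inT (T⊆T' x)
⊢-mono T⊆T' (hyp m)  = hyp m
⊢-mono T⊆T' (mp f x) = mp (⊢-mono T⊆T' f) (⊢-mono T⊆T' x)

⊢ᵢ[]⇒IPC : ∀ {a} → [] ⊢ᵢ a → IPC a
⊢ᵢ[]⇒IPC (inT x)  = x
⊢ᵢ[]⇒IPC (mp f x) = mp (⊢ᵢ[]⇒IPC f) (⊢ᵢ[]⇒IPC x)

weaken : ∀ {ℓ} {T : Th ℓ} {Γ a b} → T , Γ ⊢ a → T , (b ∷ Γ) ⊢ a
weaken (inT x)  = inT x
weaken (hyp m)  = hyp (there m)
weaken (mp f x) = mp (weaken f) (weaken x)

hyp₀ : ∀ {Γ a} → a ∷ Γ ⊢ᵢ a
hyp₀ = hyp (here refl)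

hyp₁ : ∀ {Γ a b} → b ∷ a ∷ Γ ⊢ᵢ a
hyp₁ = hyp (there (here refl))

hyp₂ : ∀ {Γ a b c} → c ∷ b ∷ a ∷ Γ ⊢ᵢ a
hyp₂ = hyp (there (there (here refl)))

⇒-refl : ∀ a → IPC (a ⇒ a)
⇒-refl a = mp (mp (ax-S a (a ⇒ a) a) (ax-K a (a ⇒ a))) (ax-K a a)

⇒-intro : ∀ {Γ a b} → a ∷ Γ ⊢ᵢ b → Γ ⊢ᵢ a ⇒ b
⇒-intro {a = a} (inT x)           = mp (inT (ax-K _ a)) (inT x)
⇒-intro {a = a} (hyp (here refl)) = inT (⇒-refl a)
⇒-intro {a = a} (hyp (there m))   = mp (inT (ax-K _ a)) (hyp m)
⇒-intro {a = a} (mp f x)          = mp (mp (inT (ax-S a _ _)) (⇒-intro f)) (⇒-intro x)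

∧-intro : ∀ {Γ a b} → Γ ⊢ᵢ a → Γ ⊢ᵢ b → Γ ⊢ᵢ a ∧' b
∧-intro x y = mp (mp (inT (ax-∧I _ _)) x) y

∧-elimˡ : ∀ {Γ a b} → Γ ⊢ᵢ a ∧' b → Γ ⊢ᵢ a
∧-elimˡ x = mp (inT (ax-∧1 _ _)) x

∧-elimʳ : ∀ {Γ a b} → Γ ⊢ᵢ a ∧' b → Γ ⊢ᵢ b
∧-elimʳ x = mp (inT (ax-∧2 _ _)) x

¬¬-intro : ∀ {Γ a} → Γ ⊢ᵢ a → Γ ⊢ᵢ ~ ~ a
¬¬-intro d = ⇒-intro (mp hyp₀ (weaken d))

¬¬-map : ∀ {Γ a b} → IPC (a ⇒ b) → Γ ⊢ᵢ ~ ~ a → Γ ⊢ᵢ ~ ~ b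
¬¬-map f nna = ⇒-intro (mp (weaken nna) (⇒-intro (mp hyp₁ (mp (inT f) hyp₀))))

¬¬-⇒-elim : ∀ {Γ a b} → Γ ⊢ᵢ ~ ~ (a ⇒ b) → Γ ⊢ᵢ a → Γ ⊢ᵢ ~ ~ b
¬¬-⇒-elim nnf x = ⇒-intro (mp (weaken nnf) (⇒-intro (mp hyp₁ (mp hyp₀ (weaken (weaken x))))))

¬-by-cases : ∀ {Γ a χ} → a ∷ Γ ⊢ᵢ ~ χ → ~ a ∷ Γ ⊢ᵢ ~ χ → Γ ⊢ᵢ ~ χ
¬-by-cases {Γ} {a} {χ} d₁ d₀ = ⇒-intro (mp (mp (weaken (⇒-intro d₀)) ¬a) hyp₀)
  where
  ¬a : χ ∷ Γ ⊢ᵢ ~ a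
  ¬a = ⇒-intro (mp (mp (weaken (weaken (⇒-intro d₁))) hyp₀) hyp₁)

¬¬-∧ : ∀ {Γ a b} → Γ ⊢ᵢ ~ ~ a → Γ ⊢ᵢ ~ ~ b → Γ ⊢ᵢ ~ ~ (a ∧' b)
¬¬-∧ nna nnb =
  ⇒-intro (mp (weaken nna) (⇒-intro (mp (weaken (weaken nnb)) (⇒-intro (mp hyp₂ (∧-intro hyp₁ hyp₀))))))

¬-∧ˡ : ∀ {Γ a b} → Γ ⊢ᵢ ~ a → Γ ⊢ᵢ ~ (a ∧' b)
¬-∧ˡ na = ⇒-intro (mp (weaken na) (∧-elimˡ hyp₀))

¬-∧ʳ : ∀ {Γ a b} → Γ ⊢ᵢ ~ b → Γ ⊢ᵢ ~ (a ∧' b)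
¬-∧ʳ nb = ⇒-intro (mp (weaken nb) (∧-elimʳ hyp₀))

¬-∨ : ∀ {Γ a b} → Γ ⊢ᵢ ~ a → Γ ⊢ᵢ ~ b → Γ ⊢ᵢ ~ (a ∨' b)
¬-∨ na nb = ⇒-intro (mp (mp (mp (inT (ax-∨E _ _ ⊥')) (weaken na)) (weaken nb)) hyp₀)

¬¬-⇒ˡ : ∀ {Γ a b} → Γ ⊢ᵢ ~ a → Γ ⊢ᵢ ~ ~ (a ⇒ b)
¬¬-⇒ˡ na = ⇒-intro (mp hyp₀ (⇒-intro (mp (inT (ax-⊥ _)) (mp (weaken (weaken na)) hyp₀))))

¬-⇒ : ∀ {Γ a b} → Γ ⊢ᵢ ~ ~ a → Γ ⊢ᵢ ~ b → Γ ⊢ᵢ ~ (a ⇒ b)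
¬-⇒ nna nb = ⇒-intro (mp (weaken nna) (⇒-intro (mp (weaken (weaken nb)) (mp hyp₁ hyp₀))))

signed : Bool → Fm → Fm
signed true  χ = ~ ~ χ
signed false χ = ~ χ

literal : Bool → ℕ → Fm
literal true  p = var p
literal false p = ~ var p

signed-var : ∀ b {Γ p} → Γ ⊢ᵢ literal b p → Γ ⊢ᵢ signed b (var p)
signed-var true  d = ¬¬-intro d
signed-var false d = d

signed-∧ : ∀ x y {Γ a b} → Γ ⊢ᵢ signed x a → Γ ⊢ᵢ signed y b → Γ ⊢ᵢ signed (x ∧ y) (a ∧' b)
signed-∧ true  true  da db = ¬¬-∧ da db
signed-∧ true  false da db = ¬-∧ʳ db
signed-∧ false y     da db = ¬-∧ˡ da

signed-∨ : ∀ x y {Γ a b} → Γ ⊢ᵢ signed x a → Γ ⊢ᵢ signed y b → Γ ⊢ᵢ signed (x ∨ y) (a ∨' b)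
signed-∨ true  y     da db = ¬¬-map (ax-∨1 _ _) da
signed-∨ false true  da db = ¬¬-map (ax-∨2 _ _) db
signed-∨ false false da db = ¬-∨ da db

signed-⇒ : ∀ x y {Γ a b} → Γ ⊢ᵢ signed x a → Γ ⊢ᵢ signed y b → Γ ⊢ᵢ signed (x ⇒ᵇ y) (a ⇒ b)
signed-⇒ true  true  da db = ¬¬-map (ax-K _ _) db
signed-⇒ true  false da db = ¬-⇒ da db
signed-⇒ false y     da db = ¬¬-⇒ˡ da

varBound : Fm → ℕ
varBound (var p)  = suc p
varBound ⊥'       = 0
varBound ⊤'       = 0
varBound (a ∧' b) = varBound a ⊔ varBound b
varBound (a ∨' b) = varBound a ⊔ varBound b
varBound (a ⇒ b)  = varBound a ⊔ varBound b

LiteralsBelow : ℕ → (ℕ → Bool) → List Fm → Set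
LiteralsBelow n v Γ = ∀ {p} → p < n → Γ ⊢ᵢ literal (v p) p

LiteralsBelow-⊔ˡ : ∀ {m n v Γ} → LiteralsBelow (m ⊔ n) v Γ → LiteralsBelow m v Γ
LiteralsBelow-⊔ˡ {m} {n} lits p<m = lits (<-≤-trans p<m (m≤m⊔n m n))

LiteralsBelow-⊔ʳ : ∀ {m n v Γ} → LiteralsBelow (m ⊔ n) v Γ → LiteralsBelow n v Γ
LiteralsBelow-⊔ʳ {m} {n} lits p<n = lits (<-≤-trans p<n (m≤n⊔m m n))

kalmar : ∀ v χ {Γ} → LiteralsBelow (varBound χ) v Γ → Γ ⊢ᵢ signed (eval v χ) χ
kalmar v (var p)  lits = signed-var (v p) (lits (n<1+n p))
kalmar v ⊥'       lits = inT (⇒-refl ⊥')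
kalmar v ⊤'       lits = ¬¬-intro (inT ax-⊤)
kalmar v (a ∧' b) lits =
  signed-∧ (eval v a) (eval v b)
    (kalmar v a (LiteralsBelow-⊔ˡ lits)) (kalmar v b (LiteralsBelow-⊔ʳ lits))
kalmar v (a ∨' b) lits =
  signed-∨ (eval v a) (eval v b)
    (kalmar v a (LiteralsBelow-⊔ˡ lits)) (kalmar v b (LiteralsBelow-⊔ʳ lits))
kalmar v (a ⇒ b)  lits =
  signed-⇒ (eval v a) (eval v b)
    (kalmar v a (LiteralsBelow-⊔ˡ lits)) (kalmar v b (LiteralsBelow-⊔ʳ lits))

update : (ℕ → Bool) → ℕ → Bool → ℕ → Bool
update v k b p = if does (p ≟ k) then b else v p

update-≡ : ∀ v k b → update v k b k ≡ b
update-≡ v k b rewrite dec-true (k ≟ k) refl = refl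

update-< : ∀ v {k} b {p} → p < k → update v k b p ≡ v p
update-< v {k} b {p} p<k rewrite dec-false (p ≟ k) (<⇒≢ p<k) = refl

LiteralsBelow-update : ∀ {k v Γ} b → LiteralsBelow k v Γ →
                       LiteralsBelow (suc k) (update v k b) (literal b k ∷ Γ)
LiteralsBelow-update {k} {v} b lits {p} p<1+k with m<1+n⇒m<n∨m≡n p<1+k
... | inj₁ p<k  rewrite update-< v b p<k = weaken (lits p<k)
... | inj₂ refl rewrite update-≡ v p b   = hyp₀

Satisfiable : Fm → Set
Satisfiable χ = ∃ λ v → eval v χ ≡ true

RefutableBelow : Fm → ℕ → Set
RefutableBelow χ k = ∀ v {Γ} → LiteralsBelow k v Γ → Satisfiable χ ⊎ Γ ⊢ᵢ ~ χ

refutableBelow-varBound : ∀ χ → RefutableBelow χ (varBound χ)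
refutableBelow-varBound χ v lits with eval v χ in v⊨χ | kalmar v χ lits
... | true  | _   = inj₁ (v , v⊨χ)
... | false | ⊢¬χ = inj₂ ⊢¬χ

refutableBelow-pred : ∀ χ k → RefutableBelow χ (suc k) → RefutableBelow χ k
refutableBelow-pred χ k ref v lits
  with ref (update v k true) (LiteralsBelow-update true lits)
     | ref (update v k false) (LiteralsBelow-update false lits)
... | inj₁ sat | _        = inj₁ sat
... | inj₂ _   | inj₁ sat = inj₁ sat
... | inj₂ d₁  | inj₂ d₀  = inj₂ (¬-by-cases d₁ d₀)

refutableBelow-zero : ∀ χ n → RefutableBelow χ n → RefutableBelow χ zero
refutableBelow-zero χ zero    ref = ref
refutableBelow-zero χ (suc n) ref = refutableBelow-zero χ n (refutableBelow-pred χ n ref)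

satisfiable⊎refutable : ∀ χ → Satisfiable χ ⊎ IPC (~ χ)
satisfiable⊎refutable χ
  with refutableBelow-zero χ (varBound χ) (refutableBelow-varBound χ) (λ _ → false) {[]} (λ ())
... | inj₁ sat = inj₁ sat
... | inj₂ d   = inj₂ (⊢ᵢ[]⇒IPC d)

CPC-¬⇒IPC : ∀ {χ} → CPC (~ χ) → IPC (~ χ)
CPC-¬⇒IPC {χ} taut with satisfiable⊎refutable χ
... | inj₁ (v , v⊨χ) = contradiction (trans (sym (cong (_⇒ᵇ false) v⊨χ)) (taut v)) λ ()
... | inj₂ d         = d

consistent⇒satisfiable : ∀ {ℓ} {T : Th ℓ} {χ} → IPC ⊆ T → Consistent T χ → Satisfiable χ
consistent⇒satisfiable {χ = χ} IPC⊆T cons with satisfiable⊎refutable χ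
... | inj₁ sat = sat
... | inj₂ d   = contradiction (IPC⊆T d) cons

¬¬Stable : Fm → Set
¬¬Stable χ = IPC (~ ~ χ ⇒ χ)

¬¬Stable⇒⇔ : ∀ {χ} → ¬¬Stable χ → IPC (χ ⇔ ~ ~ χ)
¬¬Stable⇒⇔ stable = ⊢ᵢ[]⇒IPC (∧-intro (⇒-intro (¬¬-intro hyp₀)) (inT stable))

¬¬Stable-¬ : ∀ a → ¬¬Stable (~ a)
¬¬Stable-¬ a = ⊢ᵢ[]⇒IPC (⇒-intro (⇒-intro (mp hyp₁ (¬¬-intro hyp₀))))

¬¬Stable-∧ : ∀ {a b} → ¬¬Stable a → ¬¬Stable b → ¬¬Stable (a ∧' b)
¬¬Stable-∧ sa sb = ⊢ᵢ[]⇒IPC (⇒-intro (∧-intro (mp (inT sa) (¬¬-map (ax-∧1 _ _) hyp₀))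
                                               (mp (inT sb) (¬¬-map (ax-∧2 _ _) hyp₀))))

¬¬Stable-⇒ : ∀ {a b} → ¬¬Stable b → ¬¬Stable (a ⇒ b)
¬¬Stable-⇒ sb = ⊢ᵢ[]⇒IPC (⇒-intro (⇒-intro (mp (inT sb) (¬¬-⇒-elim hyp₁ hyp₀))))

eval-sub : ∀ w σ χ → eval w (sub σ χ) ≡ eval (λ p → eval w (σ p)) χ
eval-sub w σ (var p)  = refl
eval-sub w σ ⊥'       = refl
eval-sub w σ ⊤'       = refl
eval-sub w σ (a ∧' b) = cong₂ _∧_ (eval-sub w σ a) (eval-sub w σ b)
eval-sub w σ (a ∨' b) = cong₂ _∨_ (eval-sub w σ a) (eval-sub w σ b)
eval-sub w σ (a ⇒ b)  = cong₂ _⇒ᵇ_ (eval-sub w σ a) (eval-sub w σ b)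

eval-ext : ∀ {v v'} → (∀ p → v p ≡ v' p) → ∀ χ → eval v χ ≡ eval v' χ
eval-ext v≗v' (var p)  = v≗v' p
eval-ext v≗v' ⊥'       = refl
eval-ext v≗v' ⊤'       = refl
eval-ext v≗v' (a ∧' b) = cong₂ _∧_ (eval-ext v≗v' a) (eval-ext v≗v' b)
eval-ext v≗v' (a ∨' b) = cong₂ _∨_ (eval-ext v≗v' a) (eval-ext v≗v' b)
eval-ext v≗v' (a ⇒ b)  = cong₂ _⇒ᵇ_ (eval-ext v≗v' a) (eval-ext v≗v' b)

projector : Fm → (ℕ → Bool) → Subst
projector ψ w₀ p = if w₀ p then ψ ⇒ var p else ψ ∧' var p

eval-projector-sat : ∀ ψ w₀ {w} → eval w ψ ≡ true → ∀ p → eval w (projector ψ w₀ p) ≡ w p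
eval-projector-sat ψ w₀ w⊨ψ p with w₀ p
... | true  rewrite w⊨ψ = refl
... | false rewrite w⊨ψ = refl

eval-projector-unsat : ∀ ψ w₀ {w} → eval w ψ ≡ false → ∀ p → eval w (projector ψ w₀ p) ≡ w₀ p
eval-projector-unsat ψ w₀ w⊭ψ p with w₀ p
... | true  rewrite w⊭ψ = refl
... | false rewrite w⊭ψ = refl

projector-valid : ∀ {ψ w₀} → eval w₀ ψ ≡ true → CPC (sub (projector ψ w₀) ψ)
projector-valid {ψ} {w₀} w₀⊨ψ w with eval w ψ in w⊨?ψ
... | true  = begin
  eval w (sub (projector ψ w₀) ψ)            ≡⟨ eval-sub w (projector ψ w₀) ψ ⟩
  eval (λ p → eval w (projector ψ w₀ p)) ψ   ≡⟨ eval-ext (eval-projector-sat ψ w₀ w⊨?ψ) ψ ⟩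
  eval w ψ                                   ≡⟨ w⊨?ψ ⟩
  true                                       ∎
  where open ≡-Reasoning
... | false = begin
  eval w (sub (projector ψ w₀) ψ)            ≡⟨ eval-sub w (projector ψ w₀) ψ ⟩
  eval (λ p → eval w (projector ψ w₀ p)) ψ   ≡⟨ eval-ext (eval-projector-unsat ψ w₀ w⊨?ψ) ψ ⟩
  eval w₀ ψ                                  ≡⟨ w₀⊨ψ ⟩
  true                                       ∎
  where open ≡-Reasoning

projector-retract : ∀ ψ w₀ p → ψ ∷ projector ψ w₀ p ∷ [] ⊢ᵢ var p
projector-retract ψ w₀ p with w₀ p
... | true  = mp hyp₁ hyp₀
... | false = ∧-elimʳ hyp₁

projector-section : ∀ ψ w₀ p → ψ ∷ var p ∷ [] ⊢ᵢ projector ψ w₀ p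
projector-section ψ w₀ p with w₀ p
... | true  = mp (inT (ax-K _ _)) hyp₁
... | false = ∧-intro hyp₀ hyp₁

projector-¬¬Stable : ∀ {ψ} w₀ → ¬¬Stable (neg-var ψ) → ∀ p → ¬¬Stable (neg-var (projector ψ w₀ p))
projector-¬¬Stable w₀ sψ p with w₀ p
... | true  = ¬¬Stable-⇒ (¬¬Stable-¬ _)
... | false = ¬¬Stable-∧ sψ (¬¬Stable-¬ _)

lemma4p4 : ∀ {ℓ : Level} (L : Th ℓ) → IsIntermediateLogic L →
    ∀ (φ : Fm) → Consistent (Neg L) (~ φ) →
    Projective (Stable (Neg L)) (Neg L) (~ φ)
lemma4p4 L isL φ cons = σ , stable , unifies , λ p → retract p , section p
  where
  open IsIntermediateTheory (IsIntermediateLogic.isTheory isL) using (ipc⊆)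

  IPC⊆L¬ : IPC ⊆ Neg L
  IPC⊆L¬ = IPC⊆Neg ipc⊆

  w₀⊨¬φ : Satisfiable (~ φ)
  w₀⊨¬φ = consistent⇒satisfiable {χ = ~ φ} IPC⊆L¬ cons

  w₀ : ℕ → Bool
  w₀ = proj₁ w₀⊨¬φ

  σ : Subst
  σ = projector (~ φ) w₀

  stable : Stable (Neg L) σ
  stable p = ipc⊆ (¬¬Stable⇒⇔ (projector-¬¬Stable w₀ (¬¬Stable-¬ (neg-var φ)) p))

  unifies : Neg L (sub σ (~ φ))
  unifies = IPC⊆L¬ (CPC-¬⇒IPC {sub σ φ} (projector-valid {~ φ} (proj₂ w₀⊨¬φ)))

  retract : ∀ p → Neg L , (~ φ ∷ σ p ∷ []) ⊢ var p
  retract p = ⊢-mono IPC⊆L¬ (projector-retract (~ φ) w₀ p)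

  section : ∀ p → Neg L , (~ φ ∷ var p ∷ []) ⊢ σ p
  section p = ⊢-mono IPC⊆L¬ (projector-section (~ φ) w₀ p)
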